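{- Let $\Theta$ be a branch of a tableau of $\mathbf{TAB}_{\mathbf{IB}}$. If a nominal $i$ occurs in the root formula of $\Theta$, then $i\in\mathrm{dom}(v_\Theta)$, i.e. the identity urfather $v_\Theta(i)$ exists.
   Context: Hybrid language: fix disjoint countably infinite sets $\mathbf{Prop}$ (propositional variables) and $\mathbf{Nom}$ (nominals). Formulas: $\varphi ::= p \mid i \mid \neg\varphi \mid \varphi\land\varphi \mid \diamondsuit\varphi \mid @_i\varphi$ with $p\in\mathbf{Prop}$, $i\in\mathbf{Nom}$; $\square\varphi$ abbreviates $\neg\diamondsuit\neg\varphi$. Tableaux of $\mathbf{TAB}_{\mathbf{IB}}$: a tableau is a well-founded tree of formulas of the form $@_i\varphi$, started from a root formula $@_i\varphi$ where $i$ does not occur in $\varphi$. Each branch (maximal path) is extended by applying the rules below as often as possible, except that nothing more is added to a branch once it is closed, or once every formula that any rule could generate already occurs on it. A branch $\Theta$ is closed if $@_i\varphi, @_i\neg\varphi\in\Theta$ for some $i,\varphi$. Rules (premises already on the branch, conclusions added to it): [$\neg\neg$] from $@_i\neg\neg\varphi$ add $@_i\varphi$; [$\land$] from $@_i(\varphi\land\psi)$ add $@_i\varphi$ and $@_i\psi$; [$\neg\land$] from $@_i\neg(\varphi\land\psi)$ split the branch into one branch with $@_i\neg\varphi$ and one with $@_i\neg\psi$; [$\diamondsuit$] from $@_i\diamondsuit\varphi$ add $@_i\diamondsuit j$ and $@_j\varphi$, where $j$ is a nominal not yet occurring on the branch, the rule is applied at most once per formula, the premise is not an accessibility formula, and (restriction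 $\mathcal{D}$) $i$ is a quasi-urfather on the branch; [$\neg\diamondsuit$] from $@_i\neg\diamondsuit\varphi$ and $@_i\diamondsuit j$ add $@_j\neg\varphi$; [$@$] from $@_i@_j\varphi$ add $@_j\varphi$; [$\neg@$] from $@_i\neg@_j\varphi$ add $@_j\neg\varphi$; [$\mathit{Id}$] from $@_i\varphi$ and $@_i j$ add $@_j\varphi$, provided $@_i\varphi$ is not an accessibility formula; [$\mathit{Ref}$] add $@_i i$ for any nominal $i$ occurring on the branch; [$\square_{\mathit{sym}}$] from $@_i\square\varphi$ and $@_j\diamondsuit i$ add $@_j\varphi$; ($\mathcal{I}$) for every nominal $i$ occurring on the branch add $@_i\neg\diamondsuit i$. An accessibility formula is a formula $@_i\diamondsuit j$ added by [$\diamondsuit$] with $j$ new. Auxiliary notions for a branch $\Theta$: $@_i\varphi$ is a quasi-subformula of $@_j\psi$ if $\varphi$ is a subformula of $\psi$, or $\varphi=\neg\chi$ with $\chi$ a subformula of $\psi$. $T^\Theta(i)=\{\varphi \mid @_i\varphi\in\Theta$ and $@_i\varphi$ is a quasi-subformula of the root formula$\}$. Nominals $i,j$ are twins in $\Theta$ if $T^\Theta(i)=T^\Theta(j)$. $i\prec_\Theta j$ if $j$ was introduced by applying [$\diamondsuit$] to a formula $@_i\diamondsuit\varphi$; $\prec_\Theta^*$ is its reflexive transitive closure. A nominal $i$ is a quasi-urfather on $\Theta$ if there are no twins $j\neq k$ with $j\prec_\Theta^* i$ and $k\prec_\Theta^* i$. The identity urfather $v_\Theta(i)$ of a nominal $i$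 occurring in $\Theta$ is the earliest introduced nominal $j$ on $\Theta$ that is a twin of $i$ and a quasi-urfather on $\Theta$, if such $j$ exists; $\mathrm{dom}(v_\Theta)$ is the set of nominals $i$ for which $v_\Theta(i)$ exists. -}

module Defs where

open import Data.Nat using (ℕ; zero; suc; _≤_)
open import Data.Nat.Properties using (_≟_)
open import Data.Product using (Σ; ∃; ∃-syntax; _×_; _,_)
open import Data.Sum using (_⊎_)
open import Data.List using (List; []; _∷_; [_]; _++_; concatMap)
open import Data.List.Membership.Propositional using (_∈_)
open import Data.List.Relation.Binary.Subset.Propositional using (_⊆_)
open import Data.List.Relation.Unary.Any using (Any)
open import Relation.Binary.PropositionalEquality using (_≡_; _≢_)
open import Relation.Binary.Construct.Closure.ReflexiveTransitive using (Star)
open import Relation.Nullary using (¬_; yes; no)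

-- Hybrid language.  Prop = ℕ (via `prop`), Nom = ℕ (via `nom`);
-- the two sets are disjoint since they are wrapped by distinct constructors.

Nom : Set
Nom = ℕ

data Form : Set where
  prop : ℕ → Form
  nom  : Nom → Form
  ¬'_  : Form → Form
  _∧'_ : Form → Form → Form
  ◇_   : Form → Form
  at   : Nom → Form → Form

□_ : Form → Form
□ φ = ¬' (◇ (¬' φ))

-- Tableau formulas @_i φ, represented as pairs (i , φ).
TF : Set
TF = Nom × Form

data OccF (n : Nom) : Form → Set where
  o-nom : OccF n (nom n)
  o-¬   : ∀ {φ} → OccF n φ → OccF n (¬' φ)
  o-∧ˡ  : ∀ {φ ψ} → OccF n φ → OccF n (φ ∧' ψ)
  o-∧ʳ  : ∀ {φ ψ} → OccF n ψ → OccF n (φ ∧' ψ)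
  o-◇   : ∀ {φ} → OccF n φ → OccF n (◇ φ)
  o-atˡ  : ∀ {φ} → OccF n (at n φ)
  o-atʳ  : ∀ {j φ} → OccF n φ → OccF n (at j φ)

OccTF : Nom → TF → Set
OccTF n (i , φ) = n ≡ i ⊎ OccF n φ

nomsF : Form → List Nom
nomsF (prop _)  = []
nomsF (nom j)   = j ∷ []
nomsF (¬' φ)    = nomsF φ
nomsF (φ ∧' ψ)  = nomsF φ ++ nomsF ψ
nomsF (◇ φ)     = nomsF φ
nomsF (at j φ)  = j ∷ nomsF φ

nomsTF : TF → List Nom
nomsTF (i , φ) = i ∷ nomsF φ

data Sub (φ : Form) : Form → Set where
  s-refl : Sub φ φ
  s-¬    : ∀ {ψ} → Sub φ ψ → Sub φ (¬' ψ)
  s-∧ˡ   : ∀ {ψ χ} → Sub φ ψ → Sub φ (ψ ∧' χ)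
  s-∧ʳ   : ∀ {ψ χ} → Sub φ χ → Sub φ (ψ ∧' χ)
  s-◇    : ∀ {ψ} → Sub φ ψ → Sub φ (◇ ψ)
  s-at    : ∀ {j ψ} → Sub φ ψ → Sub φ (at j ψ)

QuasiSub : TF → TF → Set
QuasiSub (i , φ) (j , ψ) = Sub φ ψ ⊎ (∃[ χ ] (φ ≡ ¬' χ × Sub χ ψ))

-- A branch is recorded by its root formula together with the chronological
-- list of rule applications performed on it.  A [◇]-application is recorded
-- with its premise @_i ◇ φ and its new nominal j (it adds @_i◇j and @_j φ);
-- every other rule application is recorded by the list of formulas it adds.

data Step : Set where
  diaStep   : Nom → Form → Nom → Step
  plainStep : List TF → Step

added : Step → List TF
added (diaStep i φ j) = (i , ◇ nom j) ∷ (j , φ) ∷ []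
added (plainStep Δ)   = Δ

forms : TF → List Step → List TF
forms r hs = r ∷ concatMap added hs

module _ (r : TF) (hs : List Step) where

  private
    F : List TF
    F = forms r hs

  NomOn : Nom → Set
  NomOn n = Any (OccTF n) F

  Closed : Set
  Closed = ∃[ i ] ∃[ φ ] ((i , φ) ∈ F × (i , ¬' φ) ∈ F)

  IsAcc : TF → Set
  IsAcc (i , χ) = ∃[ ψ ] ∃[ k ] (χ ≡ ◇ nom k × diaStep i ψ k ∈ hs)

  InT : Nom → Form → Set
  InT i φ = (i , φ) ∈ F × QuasiSub (i , φ) r

  Twins : Nom → Nom → Set
  Twins i j = ∀ φ → (InT i φ → InT j φ) × (InT j φ → InT i φ)

  Prec : Nom → Nom → Set
  Prec i j = ∃[ φ ] (diaStep i φ j ∈ hs)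

  Prec* : Nom → Nom → Set
  Prec* = Star Prec

  QuasiUrfather : Nom → Set
  QuasiUrfather i =
    ¬ (∃[ j ] ∃[ k ] (j ≢ k × Prec* j i × Prec* k i × Twins j k))

  DiaApp : Nom → Form → Nom → Set
  DiaApp i φ j =
    (i , ◇ φ) ∈ F × ¬ NomOn j × (¬ (∃[ k ] (diaStep i φ k ∈ hs)))
    × ¬ IsAcc (i , ◇ φ) × QuasiUrfather i

  -- all other rules; the index lists the alternative branch extensions
  -- (two alternatives for [¬∧], one for all other rules)
  data RuleApp : List (List TF) → Set where
    r-¬¬  : ∀ {i φ} → (i , ¬' (¬' φ)) ∈ F → RuleApp [ [ (i , φ) ] ]
    r-∧   : ∀ {i φ ψ} → (i , φ ∧' ψ) ∈ F → RuleApp [ (i , φ) ∷ (i , ψ) ∷ [] ]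
    r-¬∧  : ∀ {i φ ψ} → (i , ¬' (φ ∧' ψ)) ∈ F
          → RuleApp ([ (i , ¬' φ) ] ∷ [ (i , ¬' ψ) ] ∷ [])
    r-¬◇  : ∀ {i j φ} → (i , ¬' (◇ φ)) ∈ F → (i , ◇ nom j) ∈ F
          → RuleApp [ [ (j , ¬' φ) ] ]
    r-at   : ∀ {i j φ} → (i , at j φ) ∈ F → RuleApp [ [ (j , φ) ] ]
    r-¬at  : ∀ {i j φ} → (i , ¬' (at j φ)) ∈ F → RuleApp [ [ (j , ¬' φ) ] ]
    r-Id  : ∀ {i j φ} → (i , φ) ∈ F → (i , nom j) ∈ F → ¬ IsAcc (i , φ)
          → RuleApp [ [ (j , φ) ] ]
    r-Ref : ∀ {i} → NomOn i → RuleApp [ [ (i , nom i) ] ]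
    r-□sym : ∀ {i j φ} → (i , □ φ) ∈ F → (j , ◇ nom i) ∈ F
           → RuleApp [ [ (j , φ) ] ]
    r-I   : ∀ {i} → NomOn i → RuleApp [ [ (i , ¬' (◇ nom i)) ] ]

  Saturated : Set
  Saturated =
    (∀ alts → RuleApp alts → Any (λ Δ → Δ ⊆ F) alts)
    × (∀ i φ j → ¬ DiaApp i φ j)

  Legal : Step → Set
  Legal (diaStep i φ j) = DiaApp i φ j
  Legal (plainStep Δ)   = ∃[ alts ] (RuleApp alts × Δ ∈ alts)

  -- position of the first occurrence of a nominal in the branch
  -- (order of introduction of nominals)
  firstIndex : Nom → ℕ
  firstIndex n = go (concatMap nomsTF F)
    where
    go : List Nom → ℕ
    go [] = zero
    go (m ∷ ms) with n ≟ m
    ... | yes _ = zero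
    ... | no  _ = suc (go ms)

  IdUrfather : Nom → Nom → Set
  IdUrfather i j =
    NomOn j × Twins i j × QuasiUrfather j
    × (∀ k → NomOn k → Twins i k → QuasiUrfather k → firstIndex j ≤ firstIndex k)

  InDomV : Nom → Set
  InDomV i = NomOn i × ∃[ j ] IdUrfather i j

data Reachable (r : TF) : List Step → Set where
  start  : Reachable r []
  extend : ∀ {hs s} → Reachable r hs → ¬ Closed r hs → ¬ Saturated r hs
         → Legal r hs s → Reachable r (hs ++ [ s ])

GoodRoot : TF → Set
GoodRoot (i , φ) = ¬ OccF i φ

IsBranch : TF → List Step → Set
IsBranch r hs = GoodRoot r × Reachable r hs × (Closed r hs ⊎ Saturated r hs)

{-# OPTIONS --safe #-}
module Submission where

-- A nominal i of the root formula is never introduced by [◇], whose nominals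
-- are fresh, so i has no proper ≺-ancestor and is trivially a quasi-urfather;
-- being its own twin, it lies in the set of twins of i that are
-- quasi-urfathers.  On a finite branch both properties are decidable: T^Θ only
-- ranges over the finitely many quasi-subformulas of the root, and ≺* is
-- decided along the history of the branch, each [◇]-step adding a single edge
-- into a fresh nominal.  Hence the earliest introduced member of that set can
-- be computed, and it is v_Θ(i).

open import Defs
open import Data.List using (List; []; _∷_; [_]; _++_; map; concatMap; filter)
open import Data.List.Extrema.Nat using (argmin; argmin-all; f[argmin]≤f[xs])
open import Data.List.Membership.Propositional using (_∈_; lose)
open import Data.List.Membership.Propositional.Properties
  using ( ∈-++⁻; ∈-++⁺ˡ; ∈-++⁺ʳ; ∈-map⁺; ∈-map⁻; ∈-concatMap⁺; ∈-concatMap⁻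
        ; ∈-filter⁺; ∈-filter⁻ )
open import Data.List.Relation.Unary.All as All using (all?)
open import Data.List.Relation.Unary.Any as Any using (Any; here; there; any?)
open import Data.Nat using (_≤_)
open import Data.Nat.Properties using (_≟_)
open import Data.Product using (∃; _×_; _,_; proj₁; proj₂)
import Data.Product.Properties as Product
open import Data.Sum using (_⊎_; inj₁; inj₂)
open import Data.Empty using (⊥-elim)
open import Function using (id)
open import Relation.Binary.Construct.Closure.ReflexiveTransitive as Star using (ε; _◅_)
open import Relation.Binary.Definitions using (DecidableEquality)
open import Relation.Binary.PropositionalEquality using (_≡_; refl; sym; trans; cong)
open import Relation.Nullary using (¬_; Dec; no)
open import Relation.Nullary.Decidable using (map′; ¬?; _×-dec_; _⊎-dec_; _→-dec_)
open import Relation.Unary using (Decidable)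

dec-∃-bounded : ∀ {a p} {A : Set a} {P : A → Set p} (xs : List A) →
                (∀ {x} → P x → x ∈ xs) → Decidable P → Dec (∃ P)
dec-∃-bounded xs bound P? =
  map′ Any.satisfied (λ (x , px) → lose (bound px) px) (any? P? xs)

infix 4 _≟F_ _≟TF_

_≟F_ : DecidableEquality Form
prop p ≟F prop q = map′ (cong prop) (λ { refl → refl }) (p ≟ q)
nom i ≟F nom j = map′ (cong nom) (λ { refl → refl }) (i ≟ j)
(¬' φ) ≟F (¬' ψ) = map′ (cong ¬'_) (λ { refl → refl }) (φ ≟F ψ)
(φ ∧' ψ) ≟F (φ′ ∧' ψ′) =
  map′ (λ { (refl , refl) → refl }) (λ { refl → refl , refl }) (φ ≟F φ′ ×-dec ψ ≟F ψ′)
(◇ φ) ≟F (◇ ψ) = map′ (cong ◇_) (λ { refl → refl }) (φ ≟F ψ)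
at i φ ≟F at j ψ =
  map′ (λ { (refl , refl) → refl }) (λ { refl → refl , refl }) (i ≟ j ×-dec φ ≟F ψ)
prop _ ≟F nom _ = no λ ()
prop _ ≟F (¬' _) = no λ ()
prop _ ≟F (_ ∧' _) = no λ ()
prop _ ≟F (◇ _) = no λ ()
prop _ ≟F at _ _ = no λ ()
nom _ ≟F prop _ = no λ ()
nom _ ≟F (¬' _) = no λ ()
nom _ ≟F (_ ∧' _) = no λ ()
nom _ ≟F (◇ _) = no λ ()
nom _ ≟F at _ _ = no λ ()
(¬' _) ≟F prop _ = no λ ()
(¬' _) ≟F nom _ = no λ ()
(¬' _) ≟F (_ ∧' _) = no λ ()
(¬' _) ≟F (◇ _) = no λ ()
(¬' _) ≟F at _ _ = no λ ()
(_ ∧' _) ≟F prop _ = no λ ()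
(_ ∧' _) ≟F nom _ = no λ ()
(_ ∧' _) ≟F (¬' _) = no λ ()
(_ ∧' _) ≟F (◇ _) = no λ ()
(_ ∧' _) ≟F at _ _ = no λ ()
(◇ _) ≟F prop _ = no λ ()
(◇ _) ≟F nom _ = no λ ()
(◇ _) ≟F (¬' _) = no λ ()
(◇ _) ≟F (_ ∧' _) = no λ ()
(◇ _) ≟F at _ _ = no λ ()
at _ _ ≟F prop _ = no λ ()
at _ _ ≟F nom _ = no λ ()
at _ _ ≟F (¬' _) = no λ ()
at _ _ ≟F (_ ∧' _) = no λ ()
at _ _ ≟F (◇ _) = no λ ()

_≟TF_ : DecidableEquality TF
_≟TF_ = Product.≡-dec _≟_ _≟F_

open import Data.List.Membership.DecPropositional _≟TF_ using (_∈?_)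
open import Data.List.Membership.DecPropositional _≟F_ using () renaming (_∈?_ to _∈F?_)

mutual
  subformulas : Form → List Form
  subformulas φ = φ ∷ properSubformulas φ

  properSubformulas : Form → List Form
  properSubformulas (prop _) = []
  properSubformulas (nom _) = []
  properSubformulas (¬' φ) = subformulas φ
  properSubformulas (φ ∧' ψ) = subformulas φ ++ subformulas ψ
  properSubformulas (◇ φ) = subformulas φ
  properSubformulas (at _ φ) = subformulas φ

∈-subformulas⁺ : ∀ {φ ψ} → Sub φ ψ → φ ∈ subformulas ψ
∈-subformulas⁺ s-refl = here refl
∈-subformulas⁺ (s-¬ s) = there (∈-subformulas⁺ s)
∈-subformulas⁺ (s-∧ˡ s) = there (∈-++⁺ˡ (∈-subformulas⁺ s))
∈-subformulas⁺ (s-∧ʳ {ψ = ψ} s) = there (∈-++⁺ʳ (subformulas ψ) (∈-subformulas⁺ s))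
∈-subformulas⁺ (s-◇ s) = there (∈-subformulas⁺ s)
∈-subformulas⁺ (s-at s) = there (∈-subformulas⁺ s)

∈-subformulas⁻ : ∀ {φ} ψ → φ ∈ subformulas ψ → Sub φ ψ
∈-subformulas⁻ ψ (here refl) = s-refl
∈-subformulas⁻ (¬' ψ) (there m) = s-¬ (∈-subformulas⁻ ψ m)
∈-subformulas⁻ (ψ ∧' χ) (there m) with ∈-++⁻ (subformulas ψ) m
... | inj₁ m′ = s-∧ˡ (∈-subformulas⁻ ψ m′)
... | inj₂ m′ = s-∧ʳ (∈-subformulas⁻ χ m′)
∈-subformulas⁻ (◇ ψ) (there m) = s-◇ (∈-subformulas⁻ ψ m)
∈-subformulas⁻ (at _ ψ) (there m) = s-at (∈-subformulas⁻ ψ m)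

quasiSubformulas : Form → List Form
quasiSubformulas ψ = subformulas ψ ++ map ¬'_ (subformulas ψ)

∈-quasiSubformulas⁺ : ∀ {i φ k ψ} → QuasiSub (i , φ) (k , ψ) → φ ∈ quasiSubformulas ψ
∈-quasiSubformulas⁺ (inj₁ s) = ∈-++⁺ˡ (∈-subformulas⁺ s)
∈-quasiSubformulas⁺ {ψ = ψ} (inj₂ (_ , refl , s)) =
  ∈-++⁺ʳ (subformulas ψ) (∈-map⁺ ¬'_ (∈-subformulas⁺ s))

quasiSub? : ∀ e r → Dec (QuasiSub e r)
quasiSub? (i , φ) (k , ψ) =
  map′ from (∈-quasiSubformulas⁺ {i} {φ} {k}) (φ ∈F? quasiSubformulas ψ)
  where
  from : φ ∈ quasiSubformulas ψ → QuasiSub (i , φ) (k , ψ)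
  from m with ∈-++⁻ (subformulas ψ) m
  ... | inj₁ m′ = inj₁ (∈-subformulas⁻ ψ m′)
  ... | inj₂ m′ with ∈-map⁻ ¬'_ m′
  ...   | χ , m″ , refl = inj₂ (χ , refl , ∈-subformulas⁻ ψ m″)

∈-nomsF⁺ : ∀ {n φ} → OccF n φ → n ∈ nomsF φ
∈-nomsF⁺ o-nom = here refl
∈-nomsF⁺ (o-¬ o) = ∈-nomsF⁺ o
∈-nomsF⁺ (o-∧ˡ o) = ∈-++⁺ˡ (∈-nomsF⁺ o)
∈-nomsF⁺ (o-∧ʳ {φ = φ} o) = ∈-++⁺ʳ (nomsF φ) (∈-nomsF⁺ o)
∈-nomsF⁺ (o-◇ o) = ∈-nomsF⁺ o
∈-nomsF⁺ o-atˡ = here refl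
∈-nomsF⁺ (o-atʳ o) = there (∈-nomsF⁺ o)

∈-nomsF⁻ : ∀ {n} φ → n ∈ nomsF φ → OccF n φ
∈-nomsF⁻ (nom _) (here refl) = o-nom
∈-nomsF⁻ (¬' φ) m = o-¬ (∈-nomsF⁻ φ m)
∈-nomsF⁻ (φ ∧' ψ) m with ∈-++⁻ (nomsF φ) m
... | inj₁ m′ = o-∧ˡ (∈-nomsF⁻ φ m′)
... | inj₂ m′ = o-∧ʳ (∈-nomsF⁻ ψ m′)
∈-nomsF⁻ (◇ φ) m = o-◇ (∈-nomsF⁻ φ m)
∈-nomsF⁻ (at _ φ) (here refl) = o-atˡ
∈-nomsF⁻ (at _ φ) (there m) = o-atʳ (∈-nomsF⁻ φ m)

∈-nomsTF⁺ : ∀ {n e} → OccTF n e → n ∈ nomsTF e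
∈-nomsTF⁺ (inj₁ refl) = here refl
∈-nomsTF⁺ (inj₂ o) = there (∈-nomsF⁺ o)

∈-nomsTF⁻ : ∀ {n} e → n ∈ nomsTF e → OccTF n e
∈-nomsTF⁻ _ (here refl) = inj₁ refl
∈-nomsTF⁻ (_ , φ) (there m) = inj₂ (∈-nomsF⁻ φ m)

nominals : List TF → List Nom
nominals = concatMap nomsTF

∈-nominals⁺ : ∀ {n Γ} → Any (OccTF n) Γ → n ∈ nominals Γ
∈-nominals⁺ o = ∈-concatMap⁺ nomsTF (Any.map ∈-nomsTF⁺ o)

∈-nominals⁻ : ∀ {n Γ} → n ∈ nominals Γ → Any (OccTF n) Γ
∈-nominals⁻ m = Any.map (∈-nomsTF⁻ _) (∈-concatMap⁻ nomsTF m)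

∈-forms⁺ : ∀ {r hs s e} → s ∈ hs → e ∈ added s → e ∈ forms r hs
∈-forms⁺ s∈hs e∈s = there (∈-concatMap⁺ added (lose s∈hs e∈s))

module _ {r : TF} {hs : List Step} {x : Nom} {φ : Form} {y : Nom} (d : diaStep x φ y ∈ hs) where

  source-NomOn : NomOn r hs x
  source-NomOn = Any.map (λ { refl → inj₁ refl }) (∈-forms⁺ {r} d (here refl))

  target-NomOn : NomOn r hs y
  target-NomOn = Any.map (λ { refl → inj₂ (o-◇ o-nom) }) (∈-forms⁺ {r} d (here refl))

module _ {r : TF} where

  target-not-in-root : ∀ {hs x φ y} → Reachable r hs → diaStep x φ y ∈ hs → ¬ OccTF y r
  target-not-in-root (extend {hs} R _ _ app) d o with ∈-++⁻ hs d
  ... | inj₁ d′ = target-not-in-root R d′ o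
  ... | inj₂ (here refl) = proj₁ (proj₂ app) (here o)

  root-ancestor : ∀ {hs j k} → Reachable r hs → OccTF k r → Prec* r hs j k → j ≡ k
  root-ancestor R o ε = refl
  root-ancestor R o ((_ , d) ◅ p) with root-ancestor R o p
  ... | refl = ⊥-elim (target-not-in-root R d o)

  root-quasiUrfather : ∀ {hs k} → Reachable r hs → OccTF k r → QuasiUrfather r hs k
  root-quasiUrfather R o (j , j′ , j≢j′ , p , p′ , _) =
    j≢j′ (trans (root-ancestor R o p) (sym (root-ancestor R o p′)))

module _ (r : TF) (hs : List Step) where

  Twins-refl : ∀ {i} → Twins r hs i i
  Twins-refl _ = id , id

  InT⇒∈quasiSubformulas : ∀ {i φ} → InT r hs i φ → φ ∈ quasiSubformulas (proj₂ r)
  InT⇒∈quasiSubformulas {i} (_ , q) = ∈-quasiSubformulas⁺ {i} {k = proj₁ r} q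

  InT? : ∀ i φ → Dec (InT r hs i φ)
  InT? i φ = (i , φ) ∈? forms r hs ×-dec quasiSub? (i , φ) r

  twins? : ∀ i j → Dec (Twins r hs i j)
  twins? i j = map′ fromAll (λ tw → All.tabulate (λ {φ} _ → tw φ))
                 (all? agree? (quasiSubformulas (proj₂ r)))
    where
    Agree : Form → Set
    Agree φ = (InT r hs i φ → InT r hs j φ) × (InT r hs j φ → InT r hs i φ)

    agree? : ∀ φ → Dec (Agree φ)
    agree? φ = (InT? i φ →-dec InT? j φ) ×-dec (InT? j φ →-dec InT? i φ)

    fromAll : All.All Agree (quasiSubformulas (proj₂ r)) → Twins r hs i j
    fromAll agree φ = (λ t → proj₁ (All.lookup agree (InT⇒∈quasiSubformulas t)) t)
                    , (λ t → proj₂ (All.lookup agree (InT⇒∈quasiSubformulas t)) t)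

module _ (r : TF) where

  Prec-++⁺ : ∀ {hs ss j k} → Prec r hs j k → Prec r (hs ++ ss) j k
  Prec-++⁺ (φ , d) = φ , ∈-++⁺ˡ d

  Prec-++-plain⁻ : ∀ {hs Δ j k} → Prec r (hs ++ [ plainStep Δ ]) j k → Prec r hs j k
  Prec-++-plain⁻ {hs} (φ , d) with ∈-++⁻ hs d
  ... | inj₁ d′ = φ , d′
  ... | inj₂ (here ())

  module _ {hs : List Step} {x : Nom} {φ : Form} {y : Nom} (y-fresh : ¬ NomOn r hs y) where

    Prec-++-dia⁻ : ∀ {j k} → Prec r (hs ++ [ diaStep x φ y ]) j k →
                   Prec r hs j k ⊎ (j ≡ x × k ≡ y)
    Prec-++-dia⁻ (ψ , d) with ∈-++⁻ hs d
    ... | inj₁ d′ = inj₁ (ψ , d′)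
    ... | inj₂ (here refl) = inj₂ (refl , refl)

    Prec*-from-fresh : ∀ {k} → Prec* r hs y k → k ≡ y
    Prec*-from-fresh ε = refl
    Prec*-from-fresh ((_ , d) ◅ _) = ⊥-elim (y-fresh (source-NomOn d))

    Prec*-++-dia⁻ : ∀ {j k} → Prec* r (hs ++ [ diaStep x φ y ]) j k →
                    Prec* r hs j k ⊎ (k ≡ y × (j ≡ y ⊎ Prec* r hs j x))
    Prec*-++-dia⁻ ε = inj₁ ε
    Prec*-++-dia⁻ (e ◅ p) with Prec-++-dia⁻ e | Prec*-++-dia⁻ p
    ... | inj₁ e′ | inj₁ p′ = inj₁ (e′ ◅ p′)
    ... | inj₁ (_ , d) | inj₂ (_ , inj₁ refl) = ⊥-elim (y-fresh (target-NomOn d))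
    ... | inj₁ e′ | inj₂ (k≡y , inj₂ p′) = inj₂ (k≡y , inj₂ (e′ ◅ p′))
    ... | inj₂ (refl , refl) | inj₁ p′ = inj₂ (Prec*-from-fresh p′ , inj₂ ε)
    ... | inj₂ (refl , refl) | inj₂ (k≡y , _) = inj₂ (k≡y , inj₂ ε)

    Prec*-++-dia⁺ : ∀ {j k} → Prec* r hs j k ⊎ (k ≡ y × (j ≡ y ⊎ Prec* r hs j x)) →
                    Prec* r (hs ++ [ diaStep x φ y ]) j k
    Prec*-++-dia⁺ (inj₁ p) = Star.map Prec-++⁺ p
    Prec*-++-dia⁺ (inj₂ (refl , inj₁ refl)) = ε
    Prec*-++-dia⁺ (inj₂ (refl , inj₂ p)) =
      Star.map Prec-++⁺ p Star.◅◅ ((φ , ∈-++⁺ʳ hs (here refl)) ◅ ε)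

  Prec*? : ∀ {hs} → Reachable r hs → ∀ j k → Dec (Prec* r hs j k)
  Prec*? start j k = map′ (λ { refl → ε }) (λ { ε → refl ; ((_ , ()) ◅ _) }) (j ≟ k)
  Prec*? (extend {s = plainStep _} R _ _ _) j k =
    map′ (Star.map Prec-++⁺) (Star.map Prec-++-plain⁻) (Prec*? R j k)
  Prec*? (extend {s = diaStep x _ y} R _ _ (_ , y-fresh , _)) j k =
    map′ (Prec*-++-dia⁺ y-fresh) (Prec*-++-dia⁻ y-fresh)
      (Prec*? R j k ⊎-dec (k ≟ y ×-dec (j ≟ y ⊎-dec Prec*? R j x)))

  ancestor-∈ : ∀ {hs j k} → Prec* r hs j k → j ∈ k ∷ nominals (forms r hs)
  ancestor-∈ ε = here refl
  ancestor-∈ ((_ , d) ◅ _) = there (∈-nominals⁺ (source-NomOn {r} d))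

  quasiUrfather? : ∀ {hs} → Reachable r hs → ∀ k → Dec (QuasiUrfather r hs k)
  quasiUrfather? {hs} R k =
    ¬? (dec-∃-bounded ancestors (λ (_ , _ , p , _) → ancestor-∈ p) λ j →
        dec-∃-bounded ancestors (λ (_ , _ , p′ , _) → ancestor-∈ p′) λ j′ →
          ¬? (j ≟ j′) ×-dec Prec*? R j k ×-dec Prec*? R j′ k ×-dec twins? r hs j j′)
    where
    ancestors : List Nom
    ancestors = k ∷ nominals (forms r hs)

lemma5 : ∀ (r : TF) (hs : List Step) → IsBranch r hs → ∀ (i : Nom) → OccTF i r → InDomV r hs i
lemma5 r hs (_ , R , _) i i∈r =
  let (v-on , v-twin , v-qu) = v-candidate in here i∈r , v , v-on , v-twin , v-qu , v-earliest
  where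
  Candidate : Nom → Set
  Candidate k = Twins r hs i k × QuasiUrfather r hs k

  candidate? : Decidable Candidate
  candidate? k = twins? r hs i k ×-dec quasiUrfather? r R k

  candidates : List Nom
  candidates = filter candidate? (nominals (forms r hs))

  v : Nom
  v = argmin (firstIndex r hs) i candidates

  v-candidate : NomOn r hs v × Candidate v
  v-candidate = argmin-all (firstIndex r hs) {P = λ k → NomOn r hs k × Candidate k}
    (here i∈r , Twins-refl r hs , root-quasiUrfather R i∈r)
    (All.tabulate λ k∈ → let (k∈ns , ck) = ∈-filter⁻ candidate? k∈
                          in ∈-nominals⁻ k∈ns , ck)

  v-earliest : ∀ k → NomOn r hs k → Twins r hs i k → QuasiUrfather r hs k →
               firstIndex r hs v ≤ firstIndex r hs k
  v-earliest k k-on twin qu =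
    All.lookup (f[argmin]≤f[xs] i candidates)
               (∈-filter⁺ candidate? (∈-nominals⁺ k-on) (twin , qu))
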